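{- Every $(7,6)_5$-code $C \subseteq [5]^7$ with $|C| = 14$ can be extended to a $(7,6)_5$-code of size $15$, i.e., there exists $u \in [5]^7 \setminus C$ such that $C \cup \{u\}$ is a $(7,6)_5$-code.
   Context: For $m \in \mathbb{N}$, $[m] = \{1,\ldots,m\}$. An $(n,d)_q$-code is a set $C \subseteq [q]^n$ in which any two distinct words have Hamming distance at least $d$. -}

module Defs where

open import Data.Nat using (ℕ; zero; suc; _≤_)
open import Data.Fin using (Fin)
open import Data.Fin.Properties using () renaming (_≟_ to _≟ᶠ_)
open import Data.Vec using (Vec; []; _∷_)
open import Data.List using (List; length; _∷_)
open import Data.List.Membership.Propositional using (_∈_)
open import Data.List.Relation.Unary.Unique.Propositional using (Unique)
open import Relation.Binary.PropositionalEquality using (_≡_)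
open import Relation.Nullary using (¬_; yes; no)

Word : ℕ → ℕ → Set
Word q n = Vec (Fin q) n

hamming : ∀ {q n} → Word q n → Word q n → ℕ
hamming [] [] = zero
hamming (x ∷ xs) (y ∷ ys) with x ≟ᶠ y
... | yes _ = hamming xs ys
... | no _  = suc (hamming xs ys)

IsCode : ∀ {q n} → ℕ → List (Word q n) → Set
IsCode {q} {n} d C =
  Unique C × (∀ (x y : Word q n) → x ∈ C → y ∈ C → ¬ x ≡ y → d ≤ hamming x y)
  where open import Data.Product using (_×_)

-- Double counting. Let N i a be the number of codewords with symbol a at
-- coordinate i. Summing over ordered pairs of codewords the number of
-- coordinates in which they agree gives ∑ᵢ ∑ₐ (N i a)², and since distinct
-- codewords agree in at most one coordinate this is at most 14 · (7 + 13) = 280.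
-- On the other hand ∑ₐ N i a = 14 and h² ≥ 5h − 6 (that is, (h − 2)(h − 3) ≥ 0),
-- so ∑ₐ (N i a)² ≥ 40 for each of the 7 coordinates. Hence equality holds
-- throughout: any two codewords agree in exactly one coordinate, and at each
-- coordinate i every symbol occurs three times except one rare symbol, which
-- occurs twice. The word u of rare symbols agrees with a codeword c in exactly
-- ∑ᵢ (3 − N i cᵢ) = 21 − 20 = 1 coordinate, so it is at distance 6 from all of C.
module Submission where

open import Defs
open import Data.Nat using (ℕ; zero; suc; _+_; _*_; _∸_; _≤_; _<_; z≤n; s≤s)
open import Data.Nat.Properties
open import Data.Nat.Tactic.RingSolver using (solve-∀)
open import Data.Fin using (Fin; punchIn) renaming (zero to fz; suc to fs)
open import Data.Fin.Properties using (punchInᵢ≢i) renaming (_≟_ to _≟ᶠ_)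
open import Data.Vec using ([]; _∷_; lookup; tabulate)
open import Data.Vec.Properties using (lookup∘tabulate)
open import Data.List as List using (List; length; _∷_)
open import Data.List.Membership.Propositional using (_∈_; _∉_)
open import Data.List.Membership.Propositional.Properties using (∈-lookup)
open import Data.List.Relation.Unary.All as All using ()
open import Data.List.Relation.Unary.AllPairs using (_∷_)
open import Data.List.Relation.Unary.Any using (here; there; index)
open import Data.List.Relation.Unary.Any.Properties using (lookup-index)
open import Data.List.Relation.Unary.Unique.Propositional using (Unique)
open import Data.Product using (Σ; _×_; _,_; proj₁; proj₂; ∃-syntax)
open import Data.Sum using (_⊎_; inj₁; inj₂; [_,_]′)
open import Function using (_∘_)
open import Relation.Nullary using (yes; no; contradiction)
open import Relation.Binary.PropositionalEquality
open import Algebra.Properties.Semiring.Sum +-*-semiring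
  using (sum; sum-syntax; sum-cong-≗; sum-remove; ∑-comm; ∑-distrib-+;
         sum-replicate-zero; *-distribˡ-sum; *-distribʳ-sum)

private
  variable
    q n m : ℕ

sum-const : ∀ n k → ∑[ i < n ] k ≡ n * k
sum-const zero    k = refl
sum-const (suc n) k = cong (k +_) (sum-const n k)

sum-mono-≤ : {f g : Fin n → ℕ} → (∀ i → f i ≤ g i) → sum f ≤ sum g
sum-mono-≤ {zero}  f≤g = z≤n
sum-mono-≤ {suc n} f≤g = +-mono-≤ (f≤g fz) (sum-mono-≤ (f≤g ∘ fs))

sum-tight : {f g : Fin n → ℕ} → (∀ i → f i ≤ g i) → sum g ≤ sum f → ∀ i → f i ≡ g i
sum-tight {suc n} {f} {g} f≤g g≤f fz =
  ≤-antisym (f≤g fz) (+-cancelʳ-≤ _ _ _ (≤-trans g≤f (+-monoʳ-≤ (f fz) (sum-mono-≤ (f≤g ∘ fs)))))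
sum-tight {suc n} {f} {g} f≤g g≤f (fs i) =
  sum-tight (f≤g ∘ fs) (+-cancelˡ-≤ (g fz) _ _ (≤-trans g≤f (+-monoˡ-≤ _ (f≤g fz)))) i

sum-zero : {f : Fin n → ℕ} → sum f ≡ 0 → ∀ i → f i ≡ 0
sum-zero {suc n} {f} Σf≡0 fz     = m+n≡0⇒m≡0 (f fz) Σf≡0
sum-zero {suc n} {f} Σf≡0 (fs i) = sum-zero (m+n≡0⇒n≡0 (f fz) Σf≡0) i

sum-∸ : ∀ {k} {f : Fin n → ℕ} → (∀ i → f i ≤ k) → ∑[ i < n ] (k ∸ f i) + sum f ≡ n * k
sum-∸ {n} {k} {f} f≤k = begin
  ∑[ i < n ] (k ∸ f i) + sum f ≡⟨ ∑-distrib-+ (λ i → k ∸ f i) f ⟨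
  ∑[ i < n ] (k ∸ f i + f i)   ≡⟨ sum-cong-≗ (λ i → m∸n+n≡m (f≤k i)) ⟩
  ∑[ i < n ] k                 ≡⟨ sum-const n k ⟩
  n * k                        ∎
  where open ≡-Reasoning

-- Defined through _≟_, like hamming, so that one `with x ≟ᶠ y` unfolds both.
δ : Fin q → Fin q → ℕ
δ x y with x ≟ᶠ y
... | yes _ = 1
... | no _  = 0

δ-refl : (x : Fin q) → δ x x ≡ 1
δ-refl x with x ≟ᶠ x
... | yes _   = refl
... | no x≢x  = contradiction refl x≢x

δ-≢ : {x y : Fin q} → x ≢ y → δ x y ≡ 0
δ-≢ {x = x} {y} x≢y with x ≟ᶠ y
... | yes x≡y = contradiction x≡y x≢y
... | no _    = refl

δ-suc : (x y : Fin q) → δ (fs x) (fs y) ≡ δ x y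
δ-suc x y with x ≟ᶠ y
... | yes refl = refl
... | no _     = refl

sum≡1⇒δ : {f : Fin q → ℕ} → sum f ≡ 1 → ∃[ b ] (∀ a → f a ≡ δ b a)
sum≡1⇒δ {suc q} {f} Σf≡1 with f fz in f₀
... | 0 with sum≡1⇒δ {f = f ∘ fs} Σf≡1
...   | b , f≗δb = fs b , λ { fz → f₀ ; (fs a) → trans (f≗δb a) (sym (δ-suc b a)) }
sum≡1⇒δ {suc q} {f} Σf≡1 | 1 = fz , λ { fz → f₀ ; (fs a) → sum-zero (suc-injective Σf≡1) a }
sum≡1⇒δ {suc q} {f} () | suc (suc _)

δ-sift : (g : Fin q → ℕ) (x : Fin q) → g x ≡ ∑[ a < q ] (δ x a * g a)
δ-sift {suc q} g x = sym (begin
  ∑[ a < suc q ] (δ x a * g a)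
    ≡⟨ sum-remove {i = x} (λ a → δ x a * g a) ⟩
  δ x x * g x + ∑[ j < q ] (δ x (punchIn x j) * g (punchIn x j))
    ≡⟨ cong₂ _+_ (cong (_* g x) (δ-refl x)) (sum-cong-≗ off-diagonal) ⟩
  1 * g x + ∑[ j < q ] 0
    ≡⟨ cong₂ _+_ (*-identityˡ (g x)) (sum-replicate-zero q) ⟩
  g x + 0
    ≡⟨ +-identityʳ (g x) ⟩
  g x ∎)
  where
  open ≡-Reasoning
  off-diagonal : ∀ j → δ x (punchIn x j) * g (punchIn x j) ≡ 0
  off-diagonal j = cong (_* g (punchIn x j)) (δ-≢ (punchInᵢ≢i x j ∘ sym))

agreement : Word q n → Word q n → ℕ
agreement {n = n} x y = ∑[ i < n ] δ (lookup x i) (lookup y i)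

hamming+agreement : (x y : Word q n) → hamming x y + agreement x y ≡ n
hamming+agreement [] [] = refl
hamming+agreement (x ∷ xs) (y ∷ ys) with x ≟ᶠ y
... | yes _ = trans (+-suc _ _) (cong suc (hamming+agreement xs ys))
... | no _  = cong suc (hamming+agreement xs ys)

hamming≡∸agreement : (x y : Word q n) → hamming x y ≡ n ∸ agreement x y
hamming≡∸agreement {n = n} x y = begin
  hamming x y                                   ≡⟨ m+n∸n≡m (hamming x y) (agreement x y) ⟨
  hamming x y + agreement x y ∸ agreement x y   ≡⟨ cong (_∸ agreement x y) (hamming+agreement x y) ⟩
  n ∸ agreement x y                             ∎
  where open ≡-Reasoning

agreement≤∸ : ∀ {d} (x y : Word q n) → d ≤ hamming x y → agreement x y ≤ n ∸ d
agreement≤∸ {n = n} {d} x y d≤h = begin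
  agreement x y                                 ≡⟨ m+n∸m≡n (hamming x y) (agreement x y) ⟨
  hamming x y + agreement x y ∸ hamming x y     ≡⟨ cong (_∸ hamming x y) (hamming+agreement x y) ⟩
  n ∸ hamming x y                               ≤⟨ ∸-monoʳ-≤ n d≤h ⟩
  n ∸ d                                         ∎
  where open ≤-Reasoning

hamming-self : (x : Word q n) → hamming x x ≡ 0
hamming-self [] = refl
hamming-self (x ∷ xs) with x ≟ᶠ x
... | yes _   = hamming-self xs
... | no x≢x  = contradiction refl x≢x

hamming-comm : (x y : Word q n) → hamming x y ≡ hamming y x
hamming-comm [] [] = refl
hamming-comm (x ∷ xs) (y ∷ ys) with x ≟ᶠ y | y ≟ᶠ x
... | yes _   | yes _   = hamming-comm xs ys
... | no _    | no _    = cong suc (hamming-comm xs ys)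
... | yes x≡y | no y≢x  = contradiction (sym x≡y) y≢x
... | no x≢y  | yes y≡x = contradiction (sym y≡x) x≢y

agreement-self : (x : Word q n) → agreement x x ≡ n
agreement-self x = trans (cong (_+ agreement x x) (sym (hamming-self x))) (hamming+agreement x x)

count : (Fin m → Word q n) → Fin n → Fin q → ℕ
count {m} w i a = ∑[ k < m ] δ (lookup (w k) i) a

sum-by-count : (w : Fin m → Word q n) (i : Fin n) (g : Fin q → ℕ) →
  ∑[ k < m ] g (lookup (w k) i) ≡ ∑[ a < q ] (count w i a * g a)
sum-by-count {m} {q} w i g = begin
  ∑[ k < m ] g (lookup (w k) i)
    ≡⟨ sum-cong-≗ (λ k → δ-sift g (lookup (w k) i)) ⟩
  ∑[ k < m ] ∑[ a < q ] (δ (lookup (w k) i) a * g a)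
    ≡⟨ ∑-comm (λ k a → δ (lookup (w k) i) a * g a) ⟩
  ∑[ a < q ] ∑[ k < m ] (δ (lookup (w k) i) a * g a)
    ≡⟨ sum-cong-≗ (λ a → *-distribʳ-sum (g a) (λ k → δ (lookup (w k) i) a)) ⟨
  ∑[ a < q ] (count w i a * g a) ∎
  where open ≡-Reasoning

sum-count : (w : Fin m → Word q n) (i : Fin n) → ∑[ a < q ] count w i a ≡ m
sum-count {m} {q} w i = begin
  ∑[ a < q ] count w i a         ≡⟨ sum-cong-≗ (λ a → *-identityʳ (count w i a)) ⟨
  ∑[ a < q ] (count w i a * 1)   ≡⟨ sum-by-count w i (λ _ → 1) ⟨
  ∑[ k < m ] 1                   ≡⟨ sum-const m 1 ⟩
  m * 1                          ≡⟨ *-identityʳ m ⟩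
  m                              ∎
  where open ≡-Reasoning

sum-agreement≡sum-count : (w : Fin m → Word q n) (x : Word q n) →
  ∑[ k < m ] agreement (w k) x ≡ ∑[ i < n ] count w i (lookup x i)
sum-agreement≡sum-count w x = ∑-comm (λ k i → δ (lookup (w k) i) (lookup x i))

sum-agreement≡sum-count² : (w : Fin m → Word q n) →
  ∑[ k < m ] ∑[ k′ < m ] agreement (w k′) (w k) ≡ ∑[ i < n ] ∑[ a < q ] (count w i a * count w i a)
sum-agreement≡sum-count² {m} {q} {n} w = begin
  ∑[ k < m ] ∑[ k′ < m ] agreement (w k′) (w k)          ≡⟨ sum-cong-≗ (sum-agreement≡sum-count w ∘ w) ⟩
  ∑[ k < m ] ∑[ i < n ] count w i (lookup (w k) i)       ≡⟨ ∑-comm (λ k i → count w i (lookup (w k) i)) ⟩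
  ∑[ i < n ] ∑[ k < m ] count w i (lookup (w k) i)       ≡⟨ sum-cong-≗ (λ i → sum-by-count w i (count w i)) ⟩
  ∑[ i < n ] ∑[ a < q ] (count w i a * count w i a)      ∎
  where open ≡-Reasoning

sum-agreement≤ : ∀ {t} (w : Fin (suc m) → Word q n) →
  (∀ {k k′} → k ≢ k′ → agreement (w k′) (w k) ≤ t) →
  ∀ k → ∑[ k′ < suc m ] agreement (w k′) (w k) ≤ n + m * t
sum-agreement≤ {m} {n = n} {t} w close k = begin
  ∑[ k′ < suc m ] agreement (w k′) (w k)
    ≡⟨ sum-remove {i = k} (λ k′ → agreement (w k′) (w k)) ⟩
  agreement (w k) (w k) + ∑[ j < m ] agreement (w (punchIn k j)) (w k)
    ≤⟨ +-mono-≤ (≤-reflexive (agreement-self (w k))) (sum-mono-≤ (λ j → close (punchInᵢ≢i k j ∘ sym))) ⟩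
  n + ∑[ j < m ] t
    ≡⟨ cong (n +_) (sum-const m t) ⟩
  n + m * t ∎
  where open ≤-Reasoning

square-excess : ∀ k → (4 + k) * (4 + k) + 6 ≡ 5 * (4 + k) + (2 + k * (3 + k))
square-excess = solve-∀

5*h≤h*h+6 : ∀ h → 5 * h ≤ h * h + 6
5*h≤h*h+6 0 = z≤n
5*h≤h*h+6 1 = m≤m+n 5 2
5*h≤h*h+6 2 = ≤-refl
5*h≤h*h+6 3 = ≤-refl
5*h≤h*h+6 (suc (suc (suc (suc k)))) =
  ≤-trans (m≤m+n _ (2 + k * (3 + k))) (≤-reflexive (sym (square-excess k)))

5*h≡h*h+6⇒h≡2⊎h≡3 : ∀ h → 5 * h ≡ h * h + 6 → h ≡ 2 ⊎ h ≡ 3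
5*h≡h*h+6⇒h≡2⊎h≡3 0 ()
5*h≡h*h+6⇒h≡2⊎h≡3 1 ()
5*h≡h*h+6⇒h≡2⊎h≡3 2 _ = inj₁ refl
5*h≡h*h+6⇒h≡2⊎h≡3 3 _ = inj₂ refl
5*h≡h*h+6⇒h≡2⊎h≡3 (suc (suc (suc (suc k)))) eq
  with () ← +-cancelˡ-≡ (5 * (4 + k)) 0 _ (trans (+-identityʳ _) (trans eq (square-excess k)))

module Extension (w : Fin 14 → Word 5 7)
                 (code : ∀ {k k′} → k ≢ k′ → 6 ≤ hamming (w k) (w k′)) where

  N : Fin 7 → Fin 5 → ℕ
  N = count w

  A : Fin 14 → ℕ
  A k = ∑[ k′ < 14 ] agreement (w k′) (w k)

  Q : Fin 7 → ℕ
  Q i = ∑[ a < 5 ] (N i a * N i a)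

  A≤20 : ∀ k → A k ≤ 20
  A≤20 = sum-agreement≤ w (λ {k} {k′} k≢k′ → agreement≤∸ (w k′) (w k) (code (k≢k′ ∘ sym)))

  sum-5N : ∀ i → ∑[ a < 5 ] (5 * N i a) ≡ 70
  sum-5N i = trans (sym (*-distribˡ-sum 5 (N i))) (cong (5 *_) (sum-count w i))

  sum-N²+6 : ∀ i → ∑[ a < 5 ] (N i a * N i a + 6) ≡ Q i + 30
  sum-N²+6 i = ∑-distrib-+ (λ a → N i a * N i a) (λ _ → 6)

  40≤Q : ∀ i → 40 ≤ Q i
  40≤Q i = +-cancelʳ-≤ 30 40 (Q i) (begin
    70                              ≡⟨ sum-5N i ⟨
    ∑[ a < 5 ] (5 * N i a)          ≤⟨ sum-mono-≤ (λ a → 5*h≤h*h+6 (N i a)) ⟩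
    ∑[ a < 5 ] (N i a * N i a + 6)  ≡⟨ sum-N²+6 i ⟩
    Q i + 30                        ∎)
    where open ≤-Reasoning

  sum-Q≡sum-A : ∑[ i < 7 ] Q i ≡ ∑[ k < 14 ] A k
  sum-Q≡sum-A = sym (sum-agreement≡sum-count² w)

  Q≡40 : ∀ i → 40 ≡ Q i
  Q≡40 = sum-tight 40≤Q (≤-trans (≤-reflexive sum-Q≡sum-A) (sum-mono-≤ A≤20))

  A≡20 : ∀ k → A k ≡ 20
  A≡20 = sum-tight A≤20 (≤-trans (sum-mono-≤ 40≤Q) (≤-reflexive sum-Q≡sum-A))

  N≡2⊎N≡3 : ∀ i a → N i a ≡ 2 ⊎ N i a ≡ 3
  N≡2⊎N≡3 i a = 5*h≡h*h+6⇒h≡2⊎h≡3 (N i a) (5N≡N²+6 a)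
    where
    open ≡-Reasoning
    5N≡N²+6 : ∀ a → 5 * N i a ≡ N i a * N i a + 6
    5N≡N²+6 = sum-tight (λ a → 5*h≤h*h+6 (N i a)) (≤-reflexive (begin
      ∑[ a < 5 ] (N i a * N i a + 6)  ≡⟨ sum-N²+6 i ⟩
      Q i + 30                        ≡⟨ cong (_+ 30) (Q≡40 i) ⟨
      70                              ≡⟨ sum-5N i ⟨
      ∑[ a < 5 ] (5 * N i a)          ∎))

  N≤3 : ∀ i a → N i a ≤ 3
  N≤3 i a = [ (λ N≡2 → ≤-trans (≤-reflexive N≡2) (m≤m+n 2 1)) , ≤-reflexive ]′ (N≡2⊎N≡3 i a)

  sum-3∸N : ∀ i → ∑[ a < 5 ] (3 ∸ N i a) ≡ 1
  sum-3∸N i = +-cancelʳ-≡ 14 _ 1 (begin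
    ∑[ a < 5 ] (3 ∸ N i a) + 14                  ≡⟨ cong (∑[ a < 5 ] (3 ∸ N i a) +_) (sum-count w i) ⟨
    ∑[ a < 5 ] (3 ∸ N i a) + ∑[ a < 5 ] N i a    ≡⟨ sum-∸ {f = N i} (N≤3 i) ⟩
    15                                           ∎)
    where open ≡-Reasoning

  rare-symbol : ∀ i → ∃[ b ] (∀ a → 3 ∸ N i a ≡ δ b a)
  rare-symbol i = sum≡1⇒δ (sum-3∸N i)

  rare : Fin 7 → Fin 5
  rare = proj₁ ∘ rare-symbol

  u : Word 5 7
  u = tabulate rare

  agreement-u : ∀ k → agreement u (w k) ≡ 1
  agreement-u k = +-cancelʳ-≡ 20 (agreement u (w k)) 1 (begin
    agreement u (w k) + 20
      ≡⟨ cong₂ _+_ (sum-cong-≗ rare-agrees) (sym (A≡20 k)) ⟩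
    ∑[ i < 7 ] (3 ∸ N i (x i)) + A k
      ≡⟨ cong (∑[ i < 7 ] (3 ∸ N i (x i)) +_) (sum-agreement≡sum-count w (w k)) ⟩
    ∑[ i < 7 ] (3 ∸ N i (x i)) + ∑[ i < 7 ] N i (x i)
      ≡⟨ sum-∸ {f = λ i → N i (x i)} (λ i → N≤3 i (x i)) ⟩
    21 ∎)
    where
    open ≡-Reasoning
    x : Fin 7 → Fin 5
    x = lookup (w k)
    rare-agrees : ∀ i → δ (lookup u i) (x i) ≡ 3 ∸ N i (x i)
    rare-agrees i = trans (cong (λ b → δ b (x i)) (lookup∘tabulate rare i))
                          (sym (proj₂ (rare-symbol i) (x i)))

  hamming-u : ∀ k → hamming u (w k) ≡ 6
  hamming-u k = trans (hamming≡∸agreement u (w k)) (cong (7 ∸_) (agreement-u k))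

extension : (w : Fin m → Word 5 7) → m ≡ 14 →
  (∀ {k k′} → k ≢ k′ → 6 ≤ hamming (w k) (w k′)) → ∃[ u ] (∀ k → hamming u (w k) ≡ 6)
extension w refl code = Extension.u w code , Extension.hamming-u w code

∷-isCode : ∀ {d} {u : Word q n} {C : List (Word q n)} → 0 < d →
  (∀ {c} → c ∈ C → d ≤ hamming u c) → IsCode d C → u ∉ C × IsCode d (u ∷ C)
∷-isCode {d = d} {u} {C} 0<d far (unique , dist) =
  u∉C , (All.tabulate (λ c∈C u≡c → u∉C (subst (_∈ C) (sym u≡c) c∈C)) ∷ unique) , dist′
  where
  u∉C : u ∉ C
  u∉C u∈C = <⇒≱ 0<d (subst (d ≤_) (hamming-self u) (far u∈C))

  dist′ : ∀ x y → x ∈ u ∷ C → y ∈ u ∷ C → x ≢ y → d ≤ hamming x y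
  dist′ x y (here refl)  (here refl)  x≢y = contradiction refl x≢y
  dist′ x y (here refl)  (there y∈C) _   = far y∈C
  dist′ x y (there x∈C) (here refl)  _   = subst (d ≤_) (hamming-comm u x) (far x∈C)
  dist′ x y (there x∈C) (there y∈C)      = dist x y x∈C y∈C

lookup-injective : ∀ {A : Set} {xs : List A} → Unique xs →
  ∀ {i j} → List.lookup xs i ≡ List.lookup xs j → i ≡ j
lookup-injective (_     ∷ _) {fz}   {fz}   _ = refl
lookup-injective (x∉xs ∷ _) {fz}   {fs j} x≡xⱼ = contradiction x≡xⱼ (All.lookup x∉xs (∈-lookup j))
lookup-injective (x∉xs ∷ _) {fs i} {fz}   xᵢ≡x = contradiction (sym xᵢ≡x) (All.lookup x∉xs (∈-lookup i))
lookup-injective (_     ∷ u) {fs i} {fs j} xᵢ≡xⱼ = cong fs (lookup-injective u xᵢ≡xⱼ)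

proposition12 : (C : List (Word 5 7)) → IsCode 6 C → length C ≡ 14 →
    Σ (Word 5 7) (λ u → u ∉ C × IsCode 6 (u ∷ C))
proposition12 C isCode@(unique , dist) len = u , ∷-isCode (s≤s z≤n) far isCode
  where
  listCode : ∀ {k k′} → k ≢ k′ → 6 ≤ hamming (List.lookup C k) (List.lookup C k′)
  listCode k≢k′ = dist _ _ (∈-lookup _) (∈-lookup _) (k≢k′ ∘ lookup-injective unique)

  extended : ∃[ u ] (∀ k → hamming u (List.lookup C k) ≡ 6)
  extended = extension (List.lookup C) len listCode

  u : Word 5 7
  u = proj₁ extended

  far : ∀ {c} → c ∈ C → 6 ≤ hamming u c
  far c∈C = ≤-reflexive (sym (trans (cong (hamming u) (lookup-index c∈C)) (proj₂ extended (index c∈C))))
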